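{- Let $F, G\in \mathcal{R}$ with $F<G$ in $\mathcal{R}$, and let $\max G=q$. Then $\beta(F, G)=\sum_{j\ne i}{n-q\choose k_j-(q-k_i)}$.
   Context: Setting: $t\ge 2$, $k_1\ge k_2\ge\cdots\ge k_t$, $n\ge k_1+k_2$, and $\mathcal{A}_1\subset{[n]\choose k_1},\dots,\mathcal{A}_t\subset{[n]\choose k_t}$ are non-empty pairwise cross-intersecting families; $i\in[t]$ is a fixed index with $|\mathcal{A}_i|\ge{n-1\choose k_i-1}$, and $m=\min_{j\ne i}k_j$. Lexicographic order: for finite sets $A,B$ of positive integers, $A\prec B$ if either $A\supset B$ or $\min(A\setminus B)<\min(B\setminus A)$ (so $A\prec A$). For $R\subset[n]$ and an integer $k$, $\mathcal{L}([n],R,k)=\{F\in{[n]\choose k}: F\prec R\}$. Let $Z={n-2\choose k_i-1}+\cdots+{n-m\choose k_i-1}$, $R_0=\{1, n-k_i+2,\dots,n\}$, $R_Z=\{m, n-k_i+2,\dots,n\}$, and let $\mathcal{R}=\{R_0,R_1,\dots,R_Z\}$ be the $k_i$-subsets of $[n]$ lying between $R_0$ and $R_Z$ in lex order, listed so that each $R_j$ strictly precedes $R_{j+1}$ (i.e. $R_j\prec R_{j+1}$ and $R_j\ne R_{j+1}$); in particular $R_1=\{2,3,\dots,k_i+1\}$. For $F,G\in\mathcal{R}$, "$F<G$ in $\mathcal{R}$" means $F$ strictly precedes $G$ in lex order and no $F'\in\mathcal{R}$ strictly lies between them (i.e. $G$ is the immediate successor of $F$ in $\mathcal{R}$). Partner: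 sets $A,B$ strongly intersect at their last element $q$ if $A\cap B=\{q\}$ and $A\cup B=[q]$; then $B$ is called $A$'s partner. For $R\prec R'$ with partners $T$ and $T'$ respectively, $\beta(R,R')=\sum_{j\ne i}\big(|\mathcal{L}([n],T,k_j)|-|\mathcal{L}([n],T',k_j)|\big)$. -}

module Defs where

open import Data.Bool using (Bool; true; false; if_then_else_; _∧_; _∨_)
open import Data.Nat using (ℕ; zero; suc; _+_; _∸_; _≤_; _<_)
import Data.Nat as ℕ
open import Data.Nat.Combinatorics using (_C_)
open import Data.Integer using (ℤ; +_; -[1+_]; _-_)
import Data.Integer as ℤ
open import Data.Fin using (Fin; toℕ; _≟_)
import Data.Fin as Fin
import Data.Fin.Properties as FinP
open import Data.Fin.Subset using (Subset; _∈_; _∉_; _⊆_; _∩_; _∪_; ⁅_⁆; ∣_∣; Nonempty)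
open import Data.Fin.Subset.Properties using (_∈?_; _⊆?_)
open import Data.List using (List; []; _∷_; _++_; map)
open import Data.Nat.ListAction using (sum)
open import Data.Vec using (Vec; []; _∷_; tabulate)
open import Data.Product using (Σ; ∃; _×_; _,_)
open import Data.Sum using (_⊎_)
open import Relation.Nullary using (Dec; yes; no; ¬_; does)
open import Relation.Nullary.Decidable using (_⊎-dec_; _×-dec_; ¬?)
open import Relation.Binary.PropositionalEquality using (_≡_; _≢_)

-- Subsets of [n] are 'Subset n' (Vec Bool n); the position x : Fin n
-- stands for the positive integer  elt x = toℕ x + 1.
elt : ∀ {n} → Fin n → ℕ
elt x = suc (toℕ x)

-- Lexicographic order of the paper:
-- A ≺ B  iff  A ⊇ B  or  min(A∖B) < min(B∖A),
-- the latter written out as: some x ∈ A∖B is below every y ∈ B∖A.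
_≺_ : ∀ {n} → Subset n → Subset n → Set
A ≺ B = (B ⊆ A) ⊎ (∃ λ x → (x ∈ A × x ∉ B) × (∀ y → y ∈ B → y ∉ A → elt x < elt y))

_≺?_ : ∀ {n} (A B : Subset n) → Dec (A ≺ B)
A ≺? B = (B ⊆? A) ⊎-dec FinP.any? (λ x →
           ((x ∈? A) ×-dec ¬? (x ∈? B)) ×-dec
           FinP.all? (λ y → decImp (y ∈? B) (decImp (¬? (y ∈? A)) (elt x ℕ.<? elt y))))
  where
  decImp : ∀ {P Q : Set} → Dec P → Dec Q → Dec (P → Q)
  decImp (yes p) (yes q) = yes (λ _ → q)
  decImp (yes p) (no ¬q) = no (λ f → ¬q (f p))
  decImp (no ¬p) _ = yes (λ p → Data.Empty.⊥-elim (¬p p))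
    where import Data.Empty

allSubsets : ∀ n → List (Subset n)
allSubsets zero = [] ∷ []
allSubsets (suc n) = map (true ∷_) (allSubsets n) ++ map (false ∷_) (allSubsets n)

count : ∀ {n} → (Subset n → Bool) → ℕ
count {n} P = sum (map (λ A → if P A then 1 else 0) (allSubsets n))

Lcount : ∀ n → Subset n → ℕ → ℕ
Lcount n R k = count (λ F → does (∣ F ∣ ℕ.≟ k) ∧ does (F ≺? R))

upto : ∀ {n} → Fin n → Subset n
upto q = tabulate (λ x → does (toℕ x ℕ.≤? toℕ q))

StronglyIntersectAt : ∀ {n} → Subset n → Subset n → Fin n → Set
StronglyIntersectAt A B q = (A ∩ B ≡ ⁅ q ⁆) × (A ∪ B ≡ upto q)

IsPartner : ∀ {n} → Subset n → Subset n → Set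
IsPartner A B = ∃ λ q → StronglyIntersectAt A B q

IsMax : ∀ {n} → Fin n → Subset n → Set
IsMax q G = q ∈ G × (∀ x → x ∈ G → toℕ x ≤ toℕ q)

sumℤ : ∀ {t} → (Fin t → ℤ) → ℤ
sumℤ {zero} f = + 0
sumℤ {suc t} f = f Fin.zero ℤ.+ sumℤ (λ j → f (Fin.suc j))

sumExcept : ∀ {t} → Fin t → (Fin t → ℤ) → ℤ
sumExcept i f = sumℤ (λ j → if does (j ≟ i) then + 0 else f j)

binomℤ : ℕ → ℤ → ℕ
binomℤ a (+ b) = a C b
binomℤ a -[1+ b ] = 0

-- β(R, R') for partners T of R and T' of R'
β : ∀ {t} n (k : Fin t → ℕ) (i : Fin t) (T T' : Subset n) → ℤ
β n k i T T' = sumExcept i (λ j → + Lcount n T (k j) - + Lcount n T' (k j))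

R₀ : ∀ n (k : ℕ) → Subset n
R₀ n k = tabulate (λ x → does (elt x ℕ.≟ 1) ∨ does ((n ∸ k) + 2 ℕ.≤? elt x))

R-Z : ∀ n (k m : ℕ) → Subset n
R-Z n k m = tabulate (λ x → does (elt x ℕ.≟ m) ∨ does ((n ∸ k) + 2 ℕ.≤? elt x))

Inℛ : ∀ n (k m : ℕ) → Subset n → Set
Inℛ n k m A = (∣ A ∣ ≡ k) × (R₀ n k ≺ A) × (A ≺ R-Z n k m)

Succℛ : ∀ n (k m : ℕ) → Subset n → Subset n → Set
Succℛ n k m F G =
  Inℛ n k m F × Inℛ n k m G × (F ≺ G) × (F ≢ G) ×
  (∀ F' → Inℛ n k m F' → F ≺ F' → F' ≺ G → (F' ≡ F) ⊎ (F' ≡ G))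

Family : ℕ → Set
Family n = Subset n → Bool

_∈F_ : ∀ {n} → Subset n → Family n → Set
A ∈F 𝒜 = 𝒜 A ≡ true

Setting : ∀ (s n : ℕ) (k : Fin (suc (suc s)) → ℕ) (𝒜 : Fin (suc (suc s)) → Family n) (i : Fin (suc (suc s))) → Set
Setting s n k 𝒜 i =
  (∀ a b → toℕ a ≤ toℕ b → k b ≤ k a) ×
  (k Fin.zero + k (Fin.suc Fin.zero) ≤ n) ×
  (∀ j A → A ∈F 𝒜 j → ∣ A ∣ ≡ k j) ×
  (∀ j → ∃ λ A → A ∈F 𝒜 j) ×
  (∀ j l → j ≢ l → ∀ A B → A ∈F 𝒜 j → B ∈F 𝒜 l → Nonempty (A ∩ B)) ×
  ((n ∸ 1) C (k i ∸ 1) ≤ count (𝒜 i))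

IsMinOthers : ∀ {t} (k : Fin t → ℕ) (i : Fin t) (m : ℕ) → Set
IsMinOthers k i m = (∃ λ j → j ≢ i × k j ≡ m) × (∀ j → j ≢ i → m ≤ k j)

-- Encode sets as characteristic vectors. Then A ≺ B compares A and B at their first
-- difference, the set containing that element coming first, so |L([n], T, k)| obeys a
-- Pascal-type recursion along T. If G is the lex successor of F among the k_i-sets, F and G
-- share a prefix, after which F continues with 1 followed by the last w-set of the
-- remaining L places, and G with 0 followed by the first (w+1)-set. Partners complement
-- a set below its last element q, so on the shared prefix a common element of F and G
-- adds the same binomial to both counts, while a common non-element lowers k_j and
-- q - k_i together. At the first difference, the sets through that place are counted
-- by J-subsets of the remaining L places: all C(L, J) of them precede the partner of F,
-- and all but the C(L - w - 1, J) avoiding the first w + 1 places precede the partner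
-- of G.

module Submission where

open import Defs
open import Data.Bool using (Bool; true; false; if_then_else_; not; _∧_)
open import Data.Bool.Properties using (∧-zeroʳ; ∧-identityʳ; not-¬)
open import Data.Empty using (⊥-elim)
open import Data.Fin using (Fin; zero; suc; toℕ; _≟_)
import Data.Fin.Properties as FinP
open import Data.Fin.Subset
  using (Subset; _∈_; _∉_; _⊆_; _∪_; ⁅_⁆; ∣_∣) renaming (⊥ to ∅)
open import Data.Fin.Subset.Properties
  using (drop-there; ∉⊥; ⊥⊆; ∣p∣≤n; ∣⊥∣≡0; ⊆-antisym; p⊆p∪q; q⊆p∪q)
open import Data.Integer using (ℤ; +_; _-_; _⊖_)
import Data.Integer as ℤ
import Data.Integer.Properties as ℤP
open import Data.List using (map; _++_)
open import Data.List.Properties using (map-++; map-∘; map-cong)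
open import Data.Nat using (ℕ; zero; suc; _+_; _∸_; _≤_; _<_; z≤n; s≤s)
import Data.Nat as ℕ
import Data.Nat.Properties as ℕP
open import Data.Nat.Combinatorics using (_C_; nCk+nC[k+1]≡[n+1]C[k+1])
open import Data.Nat.ListAction using (sum)
open import Data.Nat.ListAction.Properties using (sum-++)
open import Data.Product using (_×_; _,_; proj₁; proj₂)
open import Data.Sum using (_⊎_; inj₁; inj₂) renaming (map to map⊎)
open import Data.Vec using ([]; _∷_; tabulate)
open import Data.Vec.Base using (here; there)
open import Data.Vec.Properties using (∷-injectiveˡ; ∷-injectiveʳ; tabulate-cong)
open import Function using (_∘_)
open import Relation.Binary.Definitions using (tri<; tri≈; tri>)
open import Relation.Binary.PropositionalEquality
open import Relation.Nullary using (yes; no; ¬_; does)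
open import Relation.Nullary.Decidable using (dec-true; dec-false)

private
  variable
    n : ℕ
    A B F G H T T′ : Subset n

lexᵇ : Subset n → Subset n → Bool
lexᵇ [] [] = true
lexᵇ (true ∷ A) (true ∷ B) = lexᵇ A B
lexᵇ (true ∷ A) (false ∷ B) = true
lexᵇ (false ∷ A) (true ∷ B) = false
lexᵇ (false ∷ A) (false ∷ B) = lexᵇ A B

Lex : Subset n → Subset n → Set
Lex A B = lexᵇ A B ≡ true

Lex-trans : Lex A B → Lex B H → Lex A H
Lex-trans {A = []} {[]} {[]} _ _ = refl
Lex-trans {A = true ∷ A} {true ∷ B} {true ∷ H} = Lex-trans {A = A}
Lex-trans {A = true ∷ A} {true ∷ B} {false ∷ H} _ _ = refl
Lex-trans {A = true ∷ A} {false ∷ B} {false ∷ H} _ _ = refl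
Lex-trans {A = false ∷ A} {false ∷ B} {false ∷ H} = Lex-trans {A = A}
Lex-trans {A = true ∷ A} {false ∷ B} {true ∷ H} _ ()
Lex-trans {A = false ∷ A} {true ∷ B} ()
Lex-trans {A = false ∷ A} {false ∷ B} {true ∷ H} _ ()

≺-tail : ∀ b → (b ∷ A) ≺ (b ∷ B) → A ≺ B
≺-tail b (inj₁ B⊆A) = inj₁ (drop-there ∘ B⊆A ∘ there)
≺-tail b (inj₂ (zero , (here , 0∉) , _)) = ⊥-elim (0∉ here)
≺-tail b (inj₂ (suc x , (x∈ , x∉) , below)) =
  inj₂ (x , (drop-there x∈ , x∉ ∘ there) , λ y y∈ y∉ → ℕP.≤-pred (below (suc y) (there y∈) (y∉ ∘ drop-there)))

≺-cons : ∀ b → A ≺ B → (b ∷ A) ≺ (b ∷ B)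
≺-cons b (inj₁ B⊆A) = inj₁ λ where
  here → here
  (there y∈) → there (B⊆A y∈)
≺-cons b (inj₂ (x , (x∈ , x∉) , below)) = inj₂ (suc x , (there x∈ , x∉ ∘ drop-there) , below′)
  where
  below′ : ∀ y → y ∈ (b ∷ _) → y ∉ (b ∷ _) → elt (suc x) < elt y
  below′ zero here 0∉ = ⊥-elim (0∉ here)
  below′ (suc y) (there y∈) y∉ = s≤s (below y y∈ (y∉ ∘ there))

≺⇒Lex : A ≺ B → Lex A B
≺⇒Lex {A = []} {[]} _ = refl
≺⇒Lex {A = true ∷ A} {true ∷ B} = ≺⇒Lex ∘ ≺-tail true
≺⇒Lex {A = false ∷ A} {false ∷ B} = ≺⇒Lex ∘ ≺-tail false
≺⇒Lex {A = true ∷ A} {false ∷ B} _ = refl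
≺⇒Lex {A = false ∷ A} {true ∷ B} (inj₁ B⊆A) with () ← B⊆A here
≺⇒Lex {A = false ∷ A} {true ∷ B} (inj₂ (x , _ , below)) with s≤s () ← below zero here (λ ())

Lex⇒≺ : Lex A B → A ≺ B
Lex⇒≺ {A = []} {[]} _ = inj₁ λ ()
Lex⇒≺ {A = true ∷ A} {true ∷ B} = ≺-cons true ∘ Lex⇒≺
Lex⇒≺ {A = false ∷ A} {false ∷ B} = ≺-cons false ∘ Lex⇒≺
Lex⇒≺ {suc n} {A = true ∷ A} {false ∷ B} _ = inj₂ (zero , (here , λ ()) , below)
  where
  below : ∀ y → y ∈ (false ∷ B) → y ∉ (true ∷ A) → elt {suc n} zero < elt y
  below (suc y) _ _ = s≤s (s≤s z≤n)
Lex⇒≺ {A = false ∷ A} {true ∷ B} ()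

does-≺? : ∀ (A B : Subset n) → does (A ≺? B) ≡ lexᵇ A B
does-≺? A B with lexᵇ A B in eq
... | true = dec-true (A ≺? B) (Lex⇒≺ eq)
... | false = dec-false (A ≺? B) λ A≺B → not-¬ (≺⇒Lex A≺B) eq

count-∷ : (P : Subset (suc n) → Bool) → count P ≡ count (P ∘ (true ∷_)) + count (P ∘ (false ∷_))
count-∷ {n} P = begin
  sum (map f (map (true ∷_) L ++ map (false ∷_) L))
    ≡⟨ cong sum (map-++ f (map (true ∷_) L) _) ⟩
  sum (map f (map (true ∷_) L) ++ map f (map (false ∷_) L))
    ≡⟨ sum-++ (map f (map (true ∷_) L)) _ ⟩
  sum (map f (map (true ∷_) L)) + sum (map f (map (false ∷_) L))
    ≡⟨ cong₂ _+_ (cong sum (sym (map-∘ L))) (cong sum (sym (map-∘ L))) ⟩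
  count (P ∘ (true ∷_)) + count (P ∘ (false ∷_)) ∎
  where
  open ≡-Reasoning
  L = allSubsets n
  f = λ A → if P A then 1 else 0

count-cong : {P Q : Subset n → Bool} → (∀ A → P A ≡ Q A) → count P ≡ count Q
count-cong {n} P≗Q = cong sum (map-cong (cong (λ b → if b then 1 else 0) ∘ P≗Q) (allSubsets n))

count-false : ∀ n → count {n} (λ _ → false) ≡ 0
count-false zero = refl
count-false (suc n) = trans (count-∷ {n} _) (cong₂ _+_ (count-false n) (count-false n))

count-size : ∀ n k → count {n} (λ A → does (∣ A ∣ ℕ.≟ k)) ≡ n C k
count-size zero zero = refl
count-size zero (suc k) = refl
count-size (suc n) zero = trans (count-∷ {n} _) (cong₂ _+_ (count-false n) (count-size n zero))
count-size (suc n) (suc k) =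
  trans (count-∷ {n} _) (trans (cong₂ _+_ (count-size n k) (count-size n (suc k))) (nCk+nC[k+1]≡[n+1]C[k+1] n k))

lexCount : Subset n → ℕ → ℕ
lexCount [] k = 0 C k
lexCount (true ∷ T) zero = 0
lexCount (true ∷ T) (suc k) = lexCount T k
lexCount (false ∷ T) zero = lexCount T zero
lexCount {suc n} (false ∷ T) (suc k) = n C k + lexCount T (suc k)

count-lex : ∀ (T : Subset n) k → count (λ F → does (∣ F ∣ ℕ.≟ k) ∧ lexᵇ F T) ≡ lexCount T k
count-lex [] zero = refl
count-lex [] (suc k) = refl
count-lex {suc n} (true ∷ T) zero = trans (count-∷ {n} _)
  (cong₂ _+_ (count-false n) (trans (count-cong {n} (λ _ → ∧-zeroʳ _)) (count-false n)))
count-lex {suc n} (true ∷ T) (suc k) = trans (count-∷ {n} _)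
  (trans (cong₂ _+_ (count-lex T k) (trans (count-cong {n} (λ _ → ∧-zeroʳ _)) (count-false n))) (ℕP.+-identityʳ _))
count-lex {suc n} (false ∷ T) zero = trans (count-∷ {n} _) (cong₂ _+_ (count-false n) (count-lex T zero))
count-lex {suc n} (false ∷ T) (suc k) = trans (count-∷ {n} _)
  (cong₂ _+_ (trans (count-cong {n} (λ _ → ∧-identityʳ _)) (count-size n k)) (count-lex T (suc k)))

Lcount≡lexCount : ∀ n (T : Subset n) k → Lcount n T k ≡ lexCount T k
Lcount≡lexCount n T k = trans (count-cong λ F → cong (does (∣ F ∣ ℕ.≟ k) ∧_) (does-≺? F T)) (count-lex T k)

lexCount-∅ : ∀ n k → lexCount (∅ {n}) k ≡ n C k
lexCount-∅ zero k = refl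
lexCount-∅ (suc n) zero = lexCount-∅ n zero
lexCount-∅ (suc n) (suc k) = trans (cong (_+_ (n C k)) (lexCount-∅ n (suc k))) (nCk+nC[k+1]≡[n+1]C[k+1] n k)

data Partner : ∀ {n} → Fin n → Subset n → Subset n → Set where
  last : Partner {suc n} zero ⁅ zero ⁆ ⁅ zero ⁆
  _∷_ : ∀ {q : Fin n} b → Partner q A B → Partner (suc q) (b ∷ A) (not b ∷ B)

upto-zero : upto {suc n} zero ≡ ⁅ zero ⁆
upto-zero {n} = cong (true ∷_) (tabulate-false n)
  where
  tabulate-false : ∀ n → tabulate {n = n} (λ _ → false) ≡ ∅
  tabulate-false zero = refl
  tabulate-false (suc n) = cong (false ∷_) (tabulate-false n)

upto-suc : (q : Fin n) → upto (suc q) ≡ true ∷ upto q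
upto-suc q = cong (true ∷_) (tabulate-cong λ x → suc-≤ᵇ-suc (toℕ x) (toℕ q))
  where
  suc-≤ᵇ-suc : ∀ a b → (suc a ℕ.≤ᵇ suc b) ≡ (a ℕ.≤ᵇ b)
  suc-≤ᵇ-suc zero b = refl
  suc-≤ᵇ-suc (suc a) b = refl

∪-∅ : A ∪ B ≡ ∅ → A ≡ ∅ × B ≡ ∅
∪-∅ {A = A} {B} A∪B≡∅ =
  ⊆-antisym (subst (A ⊆_) A∪B≡∅ (p⊆p∪q B)) ⊥⊆ , ⊆-antisym (subst (B ⊆_) A∪B≡∅ (q⊆p∪q A B)) ⊥⊆

stronglyIntersectAt⇒Partner : ∀ (q : Fin n) → StronglyIntersectAt A B q → Partner q A B
stronglyIntersectAt⇒Partner {A = true ∷ A} {true ∷ B} zero (_ , A∪B≡)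
  with refl , refl ← ∪-∅ (∷-injectiveʳ (trans A∪B≡ upto-zero)) = last
stronglyIntersectAt⇒Partner {A = true ∷ A} {true ∷ B} (suc q) (A∩B≡ , _) with () ← ∷-injectiveˡ A∩B≡
stronglyIntersectAt⇒Partner {A = true ∷ A} {false ∷ B} zero (A∩B≡ , _) with () ← ∷-injectiveˡ A∩B≡
stronglyIntersectAt⇒Partner {A = true ∷ A} {false ∷ B} (suc q) (A∩B≡ , A∪B≡) =
  true ∷ stronglyIntersectAt⇒Partner q (∷-injectiveʳ A∩B≡ , ∷-injectiveʳ (trans A∪B≡ (upto-suc q)))
stronglyIntersectAt⇒Partner {A = false ∷ A} {true ∷ B} zero (A∩B≡ , _) with () ← ∷-injectiveˡ A∩B≡
stronglyIntersectAt⇒Partner {A = false ∷ A} {true ∷ B} (suc q) (A∩B≡ , A∪B≡) =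
  false ∷ stronglyIntersectAt⇒Partner q (∷-injectiveʳ A∩B≡ , ∷-injectiveʳ (trans A∪B≡ (upto-suc q)))
stronglyIntersectAt⇒Partner {A = false ∷ A} {false ∷ B} zero (A∩B≡ , _) with () ← ∷-injectiveˡ A∩B≡
stronglyIntersectAt⇒Partner {A = false ∷ A} {false ∷ B} (suc q) (_ , A∪B≡)
  with () ← ∷-injectiveˡ (trans A∪B≡ (upto-suc q))

Partner⇒∈ˡ : ∀ {q : Fin n} → Partner q A B → q ∈ A
Partner⇒∈ˡ last = here
Partner⇒∈ˡ (b ∷ P) = there (Partner⇒∈ˡ P)

Partner⇒∈ʳ : ∀ {q : Fin n} → Partner q A B → q ∈ B
Partner⇒∈ʳ last = here
Partner⇒∈ʳ (b ∷ P) = there (Partner⇒∈ʳ P)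

Partner-bounded : ∀ {q : Fin n} → Partner q A B → ∀ {x} → x ∈ A → toℕ x ≤ toℕ q
Partner-bounded last here = z≤n
Partner-bounded last (there x∈∅) = ⊥-elim (∉⊥ x∈∅)
Partner-bounded (b ∷ P) here = z≤n
Partner-bounded (b ∷ P) (there x∈A) = s≤s (Partner-bounded P x∈A)

Partner-size : ∀ {q : Fin n} → Partner q A B → ∣ A ∣ ≤ elt q
Partner-size {n = suc n} last = s≤s (ℕP.≤-reflexive (∣⊥∣≡0 n))
Partner-size (true ∷ P) = s≤s (Partner-size P)
Partner-size (false ∷ P) = ℕP.m≤n⇒m≤1+n (Partner-size P)

Partner-max : ∀ {p q : Fin n} → Partner p A B → IsMax q A → p ≡ q
Partner-max P (q∈A , below) = FinP.toℕ-injective (ℕP.≤-antisym (below _ (Partner⇒∈ˡ P)) (Partner-bounded P q∈A))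

lexCount-zero : ∀ {x : Fin n} → x ∈ T → lexCount T 0 ≡ 0
lexCount-zero {T = true ∷ T} _ = refl
lexCount-zero {T = false ∷ T} (there x∈T) = lexCount-zero x∈T

lexFirst : ∀ L → ℕ → Subset L
lexFirst L zero = ∅
lexFirst zero (suc c) = []
lexFirst (suc L) (suc c) = true ∷ lexFirst L c

lexLast : ∀ L → ℕ → Subset L
lexLast zero w = []
lexLast (suc L) w with L ℕ.<? w
... | yes _ = true ∷ lexLast L (ℕ.pred w)
... | no _ = false ∷ lexLast L w

∣lexFirst∣ : ∀ {L c} → c ≤ L → ∣ lexFirst L c ∣ ≡ c
∣lexFirst∣ {L} z≤n = ∣⊥∣≡0 L
∣lexFirst∣ (s≤s c≤L) = cong suc (∣lexFirst∣ c≤L)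

∣lexLast∣ : ∀ {L w} → w ≤ L → ∣ lexLast L w ∣ ≡ w
∣lexLast∣ {zero} z≤n = refl
∣lexLast∣ {suc L} {w} w≤L with L ℕ.<? w
∣lexLast∣ {suc L} {suc w} w≤L | yes _ = cong suc (∣lexLast∣ (ℕP.≤-pred w≤L))
∣lexLast∣ {suc L} {zero} w≤L | yes ()
... | no L≮w = ∣lexLast∣ (ℕP.≮⇒≥ L≮w)

lexFirst-least : ∀ {L} (G : Subset L) → Lex (lexFirst L ∣ G ∣) G
lexFirst-least [] = refl
lexFirst-least (true ∷ G) = lexFirst-least G
lexFirst-least (false ∷ G) with ∣ G ∣ in eq
... | zero = subst (λ c → Lex (lexFirst _ c) G) eq (lexFirst-least G)
... | suc c = refl

lexLast-greatest : ∀ {L} (F : Subset L) → Lex F (lexLast L ∣ F ∣)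
lexLast-greatest [] = refl
lexLast-greatest {suc L} (b ∷ F) with L ℕ.<? ∣ b ∷ F ∣
lexLast-greatest {suc L} (true ∷ F) | yes _ = lexLast-greatest F
lexLast-greatest {suc L} (false ∷ F) | yes L<∣F∣ = ⊥-elim (ℕP.<⇒≱ L<∣F∣ (∣p∣≤n F))
lexLast-greatest {suc L} (true ∷ F) | no _ = refl
lexLast-greatest {suc L} (false ∷ F) | no _ = lexLast-greatest F

record LexSuccessor (F G : Subset n) : Set where
  field
    same-size : ∣ G ∣ ≡ ∣ F ∣
    lex : Lex F G
    distinct : F ≢ G
    immediate : ∀ H → ∣ H ∣ ≡ ∣ F ∣ → Lex F H → Lex H G → H ≡ F ⊎ H ≡ G

data Adjacent : ∀ {n} → Subset n → Subset n → Set where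
  here : ∀ {L w} → w ≤ L → Adjacent (true ∷ lexLast (suc L) w) (false ∷ lexFirst (suc L) (suc w))
  _∷_ : ∀ b → Adjacent A B → Adjacent (b ∷ A) (b ∷ B)

LexSuccessor-tail : ∀ b → LexSuccessor (b ∷ F) (b ∷ G) → LexSuccessor F G
LexSuccessor-tail true s = record
  { same-size = ℕP.suc-injective same-size
  ; lex = lex
  ; distinct = distinct ∘ cong (true ∷_)
  ; immediate = λ H ∣H∣≡ F≤H H≤G →
      map⊎ ∷-injectiveʳ ∷-injectiveʳ (immediate (true ∷ H) (cong suc ∣H∣≡) F≤H H≤G)
  }
  where open LexSuccessor s
LexSuccessor-tail false s = record
  { same-size = same-size
  ; lex = lex
  ; distinct = distinct ∘ cong (false ∷_)
  ; immediate = λ H ∣H∣≡ F≤H H≤G →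
      map⊎ ∷-injectiveʳ ∷-injectiveʳ (immediate (false ∷ H) ∣H∣≡ F≤H H≤G)
  }
  where open LexSuccessor s

LexSuccessor⇒Adjacent : LexSuccessor F G → Adjacent F G
LexSuccessor⇒Adjacent {F = []} {[]} s = ⊥-elim (LexSuccessor.distinct s refl)
LexSuccessor⇒Adjacent {F = true ∷ F} {true ∷ G} s = true ∷ LexSuccessor⇒Adjacent (LexSuccessor-tail true s)
LexSuccessor⇒Adjacent {F = false ∷ F} {false ∷ G} s = false ∷ LexSuccessor⇒Adjacent (LexSuccessor-tail false s)
LexSuccessor⇒Adjacent {F = false ∷ F} {true ∷ G} s with () ← LexSuccessor.lex s
LexSuccessor⇒Adjacent {F = true ∷ []} {false ∷ []} s with () ← LexSuccessor.same-size s
LexSuccessor⇒Adjacent {suc (suc L)} {F = true ∷ F} {false ∷ G} s =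
  subst₂ (λ X Y → Adjacent (true ∷ X) (false ∷ Y)) F-last G-first (here w≤L)
  where
  open LexSuccessor s
  w = ∣ F ∣
  w≤L : w ≤ L
  w≤L = ℕP.≤-pred (subst (_≤ suc L) same-size (∣p∣≤n G))
  F-last : lexLast (suc L) w ≡ F
  F-last with immediate (true ∷ lexLast (suc L) w) (cong suc (∣lexLast∣ (ℕP.m≤n⇒m≤1+n w≤L))) (lexLast-greatest F) refl
  ... | inj₁ eq = ∷-injectiveʳ eq
  G-first : lexFirst (suc L) (suc w) ≡ G
  G-first with immediate (false ∷ lexFirst (suc L) (suc w)) (∣lexFirst∣ (s≤s w≤L)) refl
                 (subst (λ c → Lex (lexFirst _ c) G) same-size (lexFirst-least G))
  ... | inj₂ eq = ∷-injectiveʳ eq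

¬Adjacent-∅ˡ : ¬ Adjacent (∅ {n}) B
¬Adjacent-∅ˡ {suc n} (false ∷ a) = ¬Adjacent-∅ˡ a

¬Adjacent-∅ʳ : ¬ Adjacent A (∅ {n})
¬Adjacent-∅ʳ {n = suc n} (false ∷ a) = ¬Adjacent-∅ʳ a

m+1+k≤1+n⇒m+k≤n : ∀ {m k n} → m + suc k ≤ suc n → m + k ≤ n
m+1+k≤1+n⇒m+k≤n {m} {k} {n} = ℕP.≤-pred ∘ subst (_≤ suc n) (ℕP.+-suc m k)

lexCount-partner-lexLast : ∀ {L w K} {q : Fin L} {T : Subset L} →
  Partner q (lexLast L w) T → w + K ≤ L → lexCount T K ≡ 0
lexCount-partner-lexLast {K = zero} P _ = lexCount-zero (Partner⇒∈ʳ P)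
lexCount-partner-lexLast {suc L} {w} {suc K} P w+K<L with L ℕ.<? w
lexCount-partner-lexLast {suc L} {w} {suc K} P w+K<L | yes L<w =
  ⊥-elim (ℕP.<⇒≱ L<w (ℕP.m+n≤o⇒m≤o w (m+1+k≤1+n⇒m+k≤n w+K<L)))
lexCount-partner-lexLast {suc L} {w} {suc K} (false ∷ P) w+K<L | no _ =
  lexCount-partner-lexLast P (m+1+k≤1+n⇒m+k≤n w+K<L)

lexCount-partner-true∷lexLast : ∀ {L w J} {p : Fin (suc L)} {A : Subset L} {T} →
  Partner p (true ∷ A) T → A ≡ lexLast L w → w + suc J ≤ L → lexCount T (suc J) ≡ L C J
lexCount-partner-true∷lexLast {L} {J = J} last _ _ = lexCount-∅ L J
lexCount-partner-true∷lexLast {L} {J = J} (true ∷ P) refl w+J<L =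
  trans (cong (_+_ (L C J)) (lexCount-partner-lexLast P w+J<L)) (ℕP.+-identityʳ (L C J))

Partner-lexFirst : ∀ {L c} {q : Fin L} {T} → Partner q (lexFirst L (suc c)) T → c < L → toℕ q ≡ c
Partner-lexFirst {suc L} {zero} last _ = refl
Partner-lexFirst {suc L} {zero} (true ∷ P) _ = ⊥-elim (∉⊥ (Partner⇒∈ˡ P))
Partner-lexFirst {suc (suc L)} {suc c} (true ∷ P) (s≤s c<L) = cong suc (Partner-lexFirst P c<L)

lexCount-partner-lexFirst : ∀ {L c J} {q : Fin L} {T} → Partner q (lexFirst L (suc c)) T → c < L →
  lexCount T J + (L ∸ suc c) C J ≡ L C J
lexCount-partner-lexFirst {J = zero} P _ = cong (_+ 1) (lexCount-zero (Partner⇒∈ʳ P))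
lexCount-partner-lexFirst {suc L} {zero} {suc J} last _ =
  trans (cong (_+ L C suc J) (lexCount-∅ L J)) (nCk+nC[k+1]≡[n+1]C[k+1] L J)
lexCount-partner-lexFirst {suc L} {zero} (true ∷ P) _ = ⊥-elim (∉⊥ (Partner⇒∈ˡ P))
lexCount-partner-lexFirst {suc (suc L)} {suc c} {suc J} {T = false ∷ T} (true ∷ P) (s≤s c<L) = begin
  (suc L C J + lexCount T (suc J)) + (suc L ∸ suc c) C suc J ≡⟨ ℕP.+-assoc (suc L C J) _ _ ⟩
  suc L C J + (lexCount T (suc J) + (suc L ∸ suc c) C suc J) ≡⟨ cong (_+_ (suc L C J)) (lexCount-partner-lexFirst P c<L) ⟩
  suc L C J + suc L C suc J                                   ≡⟨ nCk+nC[k+1]≡[n+1]C[k+1] (suc L) J ⟩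
  suc (suc L) C suc J                                         ∎
  where open ≡-Reasoning

lexCount-adjacent : ∀ {p q : Fin n} K → Adjacent F G → Partner p F T → Partner q G T′ → ∣ G ∣ + K ≤ n →
  lexCount T K ≡ lexCount T′ K + binomℤ (n ∸ elt q) (K ⊖ (elt q ∸ ∣ G ∣))
lexCount-adjacent {T = T} {T′ = true ∷ T′} {q = suc q} K (here {L} {w} w≤L) P (false ∷ Q) ∣G∣+K≤n
  rewrite Partner-lexFirst Q (s≤s w≤L) | ∣lexFirst∣ w≤L | ℕP.m+n∸n≡m 1 w = base K ∣G∣+K≤n
  where
  base : ∀ K → suc w + K ≤ suc (suc L) → lexCount T K ≡ lexCount (true ∷ T′) K + binomℤ (L ∸ w) (K ⊖ 1)
  base zero _ = trans (lexCount-zero (Partner⇒∈ʳ P)) (sym (ℕP.+-identityʳ _))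
  base (suc J) w+J<L = begin
    lexCount T (suc J)
      ≡⟨ lexCount-partner-true∷lexLast P refl (ℕP.≤-pred w+J<L) ⟩
    suc L C J
      ≡⟨ lexCount-partner-lexFirst Q (s≤s w≤L) ⟨
    lexCount T′ J + (L ∸ w) C J
      ≡⟨ cong (λ d → lexCount T′ J + binomℤ (L ∸ w) d) (ℤP.[1+m]⊖[1+n]≡m⊖n J 0) ⟨
    lexCount T′ J + binomℤ (L ∸ w) (suc J ⊖ 1) ∎
    where open ≡-Reasoning
lexCount-adjacent K (true ∷ a) last Q _ = ⊥-elim (¬Adjacent-∅ˡ a)
lexCount-adjacent K (true ∷ a) (true ∷ P) last _ = ⊥-elim (¬Adjacent-∅ʳ a)
lexCount-adjacent {suc n} zero (true ∷ a) (true ∷ P) (true ∷ Q) ∣G∣≤n =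
  lexCount-adjacent zero a P Q (ℕP.≤-pred ∣G∣≤n)
lexCount-adjacent {suc n} {T = false ∷ T} {T′ = false ∷ T′} (suc K) (true ∷ a) (true ∷ P) (true ∷ Q) ∣G∣+K≤n =
  trans (cong (_+_ (n C K)) (lexCount-adjacent (suc K) a P Q (ℕP.≤-pred ∣G∣+K≤n))) (sym (ℕP.+-assoc (n C K) _ _))
lexCount-adjacent {suc n} {G = false ∷ G} {T′ = true ∷ T′} {q = suc q} K (false ∷ a) (false ∷ P) (false ∷ Q) ∣G∣+K≤n
  rewrite ℕP.+-∸-assoc 1 (Partner-size Q) with K
... | zero = refl
... | suc K = trans (lexCount-adjacent K a P Q (m+1+k≤1+n⇒m+k≤n ∣G∣+K≤n))
                    (cong (λ d → lexCount T′ K + binomℤ (n ∸ elt q) d) (sym (ℤP.[1+m]⊖[1+n]≡m⊖n K (elt q ∸ ∣ G ∣))))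

+[m+n]-+m≡+n : ∀ m n → + (m + n) - + m ≡ + n
+[m+n]-+m≡+n m n = trans (ℤP.[+m]-[+n]≡m⊖n (m + n) m) (trans (ℤP.⊖-≥ (ℕP.m≤m+n m n)) (cong +_ (ℕP.m+n∸m≡n m n)))

lexCount-partners-difference : ∀ {p q : Fin n} K → LexSuccessor F G → Partner p F T → Partner q G T′ →
  ∣ G ∣ + K ≤ n → + lexCount T K - + lexCount T′ K ≡ + binomℤ (n ∸ elt q) (+ K - (+ elt q - + ∣ G ∣))
lexCount-partners-difference {n} {G = G} {T = T} {T′ = T′} {q = q} K s P Q ∣G∣+K≤n = begin
  + lexCount T K - + lexCount T′ K
    ≡⟨ cong (λ x → + x - + lexCount T′ K) (lexCount-adjacent K (LexSuccessor⇒Adjacent s) P Q ∣G∣+K≤n) ⟩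
  + (lexCount T′ K + binomℤ N (K ⊖ d)) - + lexCount T′ K
    ≡⟨ +[m+n]-+m≡+n (lexCount T′ K) _ ⟩
  + binomℤ N (K ⊖ d)
    ≡⟨ cong (λ x → + binomℤ N x) (ℤP.[+m]-[+n]≡m⊖n K d) ⟨
  + binomℤ N (+ K - + d)
    ≡⟨ cong (λ x → + binomℤ N (+ K - x)) elt-q-∣G∣ ⟨
  + binomℤ N (+ K - (+ elt q - + ∣ G ∣)) ∎
  where
  open ≡-Reasoning
  N = n ∸ elt q
  d = elt q ∸ ∣ G ∣
  elt-q-∣G∣ : + elt q - + ∣ G ∣ ≡ + d
  elt-q-∣G∣ = trans (ℤP.[+m]-[+n]≡m⊖n (elt q) ∣ G ∣) (ℤP.⊖-≥ (Partner-size Q))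

-- ℛ is an interval of the lex order.
Succℛ⇒LexSuccessor : ∀ {k m} → Succℛ n k m F G → LexSuccessor F G
Succℛ⇒LexSuccessor {n} {F} {G} {k} {m} ((∣F∣≡k , R₀≺F , _) , (∣G∣≡k , _ , G≺R-Z) , F≺G , F≢G , nothing-between) = record
  { same-size = trans ∣G∣≡k (sym ∣F∣≡k)
  ; lex = ≺⇒Lex F≺G
  ; distinct = F≢G
  ; immediate = λ H ∣H∣≡∣F∣ F≤H H≤G → nothing-between H
      ( trans ∣H∣≡∣F∣ ∣F∣≡k
      , Lex⇒≺ (Lex-trans {A = R₀ n k} {F} {H} (≺⇒Lex R₀≺F) F≤H)
      , Lex⇒≺ (Lex-trans {A = H} {G} {R-Z n k m} H≤G (≺⇒Lex G≺R-Z)))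
      (Lex⇒≺ F≤H) (Lex⇒≺ H≤G)
  }

sumℤ-cong : ∀ {t} {f g : Fin t → ℤ} → (∀ j → f j ≡ g j) → sumℤ f ≡ sumℤ g
sumℤ-cong {zero} _ = refl
sumℤ-cong {suc t} f≗g = cong₂ ℤ._+_ (f≗g zero) (sumℤ-cong (f≗g ∘ suc))

sumExcept-cong : ∀ {t} (i : Fin t) {f g : Fin t → ℤ} → (∀ j → j ≢ i → f j ≡ g j) → sumExcept i f ≡ sumExcept i g
sumExcept-cong i {f} {g} f≗g = sumℤ-cong pointwise
  where
  pointwise : ∀ j → (if does (j ≟ i) then + 0 else f j) ≡ (if does (j ≟ i) then + 0 else g j)
  pointwise j with j ≟ i
  ... | yes _ = refl
  ... | no j≢i = f≗g j j≢i

module _ {s n} (k : Fin (suc (suc s)) → ℕ) (antitone : ∀ a b → toℕ a ≤ toℕ b → k b ≤ k a)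
         (k₀+k₁≤n : k zero + k (suc zero) ≤ n) where

  antitone⇒<-pair-sum≤ : ∀ {i j} → toℕ i < toℕ j → k i + k j ≤ n
  antitone⇒<-pair-sum≤ {i} {j} i<j =
    ℕP.≤-trans (ℕP.+-mono-≤ (antitone zero i z≤n) (antitone (suc zero) j (ℕP.≤-trans (s≤s z≤n) i<j))) k₀+k₁≤n

  antitone⇒pair-sum≤ : ∀ {i j} → i ≢ j → k i + k j ≤ n
  antitone⇒pair-sum≤ {i} {j} i≢j with ℕP.<-cmp (toℕ i) (toℕ j)
  ... | tri< i<j _ _ = antitone⇒<-pair-sum≤ i<j
  ... | tri≈ _ i≡j _ = ⊥-elim (i≢j (FinP.toℕ-injective i≡j))
  ... | tri> _ _ j<i = subst (_≤ n) (ℕP.+-comm (k j) (k i)) (antitone⇒<-pair-sum≤ j<i)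

proposition6 : ∀ (s n : ℕ) (k : Fin (suc (suc s)) → ℕ) (𝒜 : Fin (suc (suc s)) → Family n) (i : Fin (suc (suc s))) (m : ℕ) →
    Setting s n k 𝒜 i → IsMinOthers k i m →
    ∀ (F G : Subset n) → Succℛ n (k i) m F G →
    ∀ (q : Fin n) → IsMax q G →
    ∀ (T T' : Subset n) → IsPartner F T → IsPartner G T' →
    β n k i T T' ≡ sumExcept i (λ j → + binomℤ (n ∸ elt q) (+ k j - (+ elt q - + k i)))
proposition6 s n k 𝒜 i m (antitone , k₀+k₁≤n , _) _ F G G-after-F q q-max T T′ (p , F∼T) (p′ , G∼T′) =
  sumExcept-cong i λ j j≢i → begin
    + Lcount n T (k j) - + Lcount n T′ (k j)
      ≡⟨ cong₂ (λ a b → + a - + b) (Lcount≡lexCount n T (k j)) (Lcount≡lexCount n T′ (k j)) ⟩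
    + lexCount T (k j) - + lexCount T′ (k j)
      ≡⟨ lexCount-partners-difference (k j) (Succℛ⇒LexSuccessor {m = m} G-after-F) P Q (∣G∣+k≤n j≢i) ⟩
    + binomℤ (n ∸ elt q) (+ k j - (+ elt q - + ∣ G ∣))
      ≡⟨ cong (λ c → + binomℤ (n ∸ elt q) (+ k j - (+ elt q - + c))) ∣G∣≡k ⟩
    + binomℤ (n ∸ elt q) (+ k j - (+ elt q - + k i)) ∎
  where
  open ≡-Reasoning
  ∣G∣≡k : ∣ G ∣ ≡ k i
  ∣G∣≡k = proj₁ (proj₁ (proj₂ G-after-F))
  P : Partner p F T
  P = stronglyIntersectAt⇒Partner p F∼T
  Q′ : Partner p′ G T′
  Q′ = stronglyIntersectAt⇒Partner p′ G∼T′
  Q : Partner q G T′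
  Q = subst (λ r → Partner r G T′) (Partner-max Q′ q-max) Q′
  ∣G∣+k≤n : ∀ {j} → j ≢ i → ∣ G ∣ + k j ≤ n
  ∣G∣+k≤n j≢i = subst (λ c → c + _ ≤ n) (sym ∣G∣≡k) (antitone⇒pair-sum≤ k antitone k₀+k₁≤n (j≢i ∘ sym))
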